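{- Let $G=(g_0,\dots,g_k)$ be a smooth sequence of positive integers with $\gcd(g_0,\dots,g_k)=1$ and $c$ values $(c_1,\dots,c_k)$, let $S=\langle G\rangle$ (a free numerical semigroup) and $\mathit{NR}=\mathbb{N}_0\setminus S$. Then for any function $f$ defined on $\mathbb{N}_0$, \[\sum_{n\in\mathit{NR}}\bigl[f(n+g_0)-f(n)\bigr]=\sum_{n_1=0}^{c_1-1}\cdots\sum_{n_k=0}^{c_k-1}f\Bigl(\sum_{i=1}^k n_ig_i\Bigr)-\sum_{n=0}^{g_0-1}f(n).\]
   Context: For a finite sequence $G=(g_0,\dots,g_k)$ of positive integers, let $d_i=\gcd(g_0,\dots,g_i)$ for $0\le i\le k$ and $c_i=d_{i-1}/d_i$ for $1\le i\le k$ (the $c$ values of $G$). $\langle H\rangle$ denotes the set of all finite non-negative integer linear combinations of elements of $H$. $G$ is smooth if $c_ig_i\in\langle g_0,\dots,g_{i-1}\rangle$ for every $1\le i\le k$. A numerical semigroup is free if it equals $\langle G\rangle$ for some $G$ with $\gcd(G)=1$ that can be ordered as a smooth sequence. -}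

module Defs where

open import Data.Nat using (ℕ; zero; suc; _+_; _*_; _≤_; _<_)
open import Data.Nat.GCD using (gcd; gcd[m,n]∣m)
open import Data.Nat.Divisibility using (_∣_)
open import Data.Product using (Σ)
open import Relation.Nullary using (Dec; yes; no)
open import Relation.Binary.PropositionalEquality using (_≡_)
open import Algebra.Bundles using (AbelianGroup)

-- A sequence G = (g_0,...,g_k) is represented by k and g : ℕ → ℕ
-- (only the values g 0, ..., g k are relevant).

sumℕ : ℕ → (ℕ → ℕ) → ℕ
sumℕ zero    h = 0
sumℕ (suc m) h = sumℕ m h + h m

-- n ∈ ⟨ g 0 , ... , g (m-1) ⟩ : n is a non-negative integer combination
-- of the first m terms (m = 0 gives the semigroup ⟨∅⟩ = {0}).
InGen : ℕ → (ℕ → ℕ) → ℕ → Set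
InGen m g n = Σ (ℕ → ℕ) (λ a → sumℕ m (λ i → a i * g i) ≡ n)

InS : ℕ → (ℕ → ℕ) → ℕ → Set
InS k g = InGen (suc k) g

dval : (ℕ → ℕ) → ℕ → ℕ
dval g zero    = g zero
dval g (suc i) = gcd (dval g i) (g (suc i))

-- c_i = d_{i-1} / d_i  (for i ≥ 1; the quotient of d_i ∣ d_{i-1}); c_0 unused
cval : (ℕ → ℕ) → ℕ → ℕ
cval g zero    = 1
cval g (suc i) = _∣_.quotient (gcd[m,n]∣m (dval g i) (g (suc i)))

Smooth : ℕ → (ℕ → ℕ) → Set
Smooth k g = (i : ℕ) → 1 ≤ i → i ≤ k → InGen i g (cval g i * g i)

module _ {a ℓ} (A : AbelianGroup a ℓ) where
  open AbelianGroup A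

  gsum : ℕ → (ℕ → Carrier) → Carrier
  gsum zero    h = ε
  gsum (suc m) h = gsum m h ∙ h m

  nrSum : (k : ℕ) (g : ℕ → ℕ) → ((n : ℕ) → Dec (InS k g n)) →
          ℕ → (ℕ → Carrier) → Carrier
  nrSum k g dec B f = gsum B term
    where
    term : ℕ → Carrier
    term n with dec n
    ... | yes _ = ε
    ... | no  _ = f (n + g 0) ∙ (f n) ⁻¹

  nested : (ℕ → ℕ) → (ℕ → Carrier) → ℕ → ℕ → Carrier
  nested g f zero    acc = f acc
  nested g f (suc j) acc =
    gsum (cval g (suc j)) (λ n → nested g f j (acc + n * g (suc j)))

module Submission where

-- Write c_i = d_{i-1}/d_i and call a digit
-- vector (n_1, …, n_k) admissible when 0 ≤ n_i < c_i.  For a smooth sequence with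
-- g_0 > 0, every element of S = ⟨g_0, …, g_k⟩ has a unique normal form
-- x g_0 + Σ n_i g_i  with admissible digits: existence by reducing coefficients
-- from the top using  c_i g_i ∈ ⟨g_0, …, g_{i-1}⟩,  uniqueness because
-- d_{i-1} ∣ δ g_i  forces  c_i ∣ δ.  Hence the values Σ n_i g_i are exactly the
-- Apéry set  {m ∈ S : m - g_0 ∉ S},  each attained once.  Phrased with
-- w(m) = #{admissible n : Σ n_i g_i = m}  and the gap indicator γ = [· ∉ S]:
--   w(m) + γ(m) = 1 for m < g_0,   and   w(g_0 + n) + γ(g_0 + n) = γ(n).
-- The nested sum is  Σ_m w(m) f(m),  the sum over NR is  Σ_n γ(n) (f(n+g_0) - f(n)),
-- and a telescoping identity in any abelian group turns the two counting
-- identities into the theorem.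

open import Defs
open import Data.Nat
  using (ℕ; zero; suc; _+_; _*_; _∸_; _≤_; _<_; z≤n; s≤s; _≟_; NonZero; >-nonZero; _/_; _%_)
open import Data.Nat.Properties
open import Data.Nat.Divisibility
open import Data.Nat.DivMod using (m≡m%n+[m/n]*n; m%n<n)
open import Data.Nat.GCD using (gcd; gcd[m,n]∣m; gcd[m,n]∣n; gcd[m,n]≢0)
open import Data.Nat.Coprimality using (Coprime; coprime-/gcd; coprime-divisor)
open import Data.Nat.Solver using (module +-*-Solver)
open import Data.Product using (Σ; _×_; _,_; proj₁; proj₂)
open import Data.Sum using (inj₁; inj₂)
open import Data.Empty using (⊥-elim)
open import Function using (_∘_)
open import Relation.Nullary using (Dec; yes; no; ¬_)
open import Relation.Binary.PropositionalEquality
  using (_≡_; _≢_; refl; sym; trans; cong; cong₂; subst; subst₂; module ≡-Reasoning)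
open import Algebra.Bundles using (AbelianGroup)

open +-*-Solver using (solve; _:+_; _:*_; _:=_)

sumℕ-cong : ∀ m {h h′ : ℕ → ℕ} → (∀ i → i < m → h i ≡ h′ i) → sumℕ m h ≡ sumℕ m h′
sumℕ-cong zero    eq = refl
sumℕ-cong (suc m) eq = cong₂ _+_ (sumℕ-cong m (λ i i<m → eq i (m<n⇒m<1+n i<m))) (eq m ≤-refl)

sumℕ-vanish : ∀ m {h : ℕ → ℕ} → (∀ i → i < m → h i ≡ 0) → sumℕ m h ≡ 0
sumℕ-vanish zero    h≡0 = refl
sumℕ-vanish (suc m) h≡0 =
  cong₂ _+_ (sumℕ-vanish m (λ i i<m → h≡0 i (m<n⇒m<1+n i<m))) (h≡0 m ≤-refl)

sumℕ-vanish⁻ : ∀ m {h : ℕ → ℕ} → sumℕ m h ≡ 0 → ∀ i → i < m → h i ≡ 0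
sumℕ-vanish⁻ (suc m) {h} sum≡0 i i<1+m with m≤n⇒m<n∨m≡n (≤-pred i<1+m)
... | inj₁ i<m  = sumℕ-vanish⁻ m (m+n≡0⇒m≡0 _ sum≡0) i i<m
... | inj₂ refl = m+n≡0⇒n≡0 (sumℕ m h) sum≡0

sumℕ-single : ∀ m {h : ℕ → ℕ} p → p < m → (∀ i → i < m → i ≢ p → h i ≡ 0) → sumℕ m h ≡ h p
sumℕ-single (suc m) {h} p p<1+m others with m≤n⇒m<n∨m≡n (≤-pred p<1+m)
... | inj₁ p<m  = trans (cong₂ _+_ (sumℕ-single m p p<m (λ i i<m → others i (m<n⇒m<1+n i<m)))
                                   (others m ≤-refl (λ m≡p → <⇒≢ p<m (sym m≡p))))
                        (+-identityʳ (h p))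
... | inj₂ refl = cong (_+ h p) (sumℕ-vanish p (λ i i<p → others i (m<n⇒m<1+n i<p) (<⇒≢ i<p)))

sumℕ-peel : ∀ m (h : ℕ → ℕ) → sumℕ (suc m) h ≡ h 0 + sumℕ m (λ i → h (suc i))
sumℕ-peel zero    h = sym (+-identityʳ (h 0))
sumℕ-peel (suc m) h = trans (cong (_+ h (suc m)) (sumℕ-peel m h)) (+-assoc (h 0) _ _)

sumℕ-combine : ∀ m (a b g : ℕ → ℕ) q →
  sumℕ m (λ i → (a i + q * b i) * g i) ≡ sumℕ m (λ i → a i * g i) + q * sumℕ m (λ i → b i * g i)
sumℕ-combine zero    a b g q = sym (*-zeroʳ q)
sumℕ-combine (suc m) a b g q =
  trans (cong (_+ (a m + q * b m) * g m) (sumℕ-combine m a b g q))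
        (solve 6 (λ S T q x y z → (S :+ q :* T) :+ (x :+ q :* y) :* z
                                  := (S :+ x :* z) :+ q :* (T :+ y :* z)) refl
               (sumℕ m (λ i → a i * g i)) (sumℕ m (λ i → b i * g i)) q (a m) (b m) (g m))

sumℕ-divisible : ∀ m {d} {h : ℕ → ℕ} → (∀ i → i < m → d ∣ h i) → d ∣ sumℕ m h
sumℕ-divisible zero    d∣h = divides 0 refl
sumℕ-divisible (suc m) d∣h =
  ∣m∣n⇒∣m+n (sumℕ-divisible m (λ i i<m → d∣h i (m<n⇒m<1+n i<m))) (d∣h m ≤-refl)

setAt : (ℕ → ℕ) → ℕ → ℕ → ℕ → ℕ
setAt n p r i with i ≟ p
... | yes _ = r
... | no  _ = n i

setAt-here : ∀ n p r → setAt n p r p ≡ r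
setAt-here n p r with p ≟ p
... | yes _   = refl
... | no  p≢p = ⊥-elim (p≢p refl)

setAt-there : ∀ n p r i → i ≢ p → setAt n p r i ≡ n i
setAt-there n p r i i≢p with i ≟ p
... | yes i≡p = ⊥-elim (i≢p i≡p)
... | no  _   = refl

-- Digit vectors for a sequence g.  A vector n (of which only n_1, …, n_j
-- matter) is admissible when 0 ≤ n_i < c_i, and its value is Σ_{i=1}^{j} n_i g_i.

module Digits (g : ℕ → ℕ) where

  digits : ℕ → (ℕ → ℕ) → ℕ
  digits j n = sumℕ j (λ i → n (suc i) * g (suc i))

  Admissible : ℕ → (ℕ → ℕ) → Set
  Admissible j n = ∀ i → i < j → n (suc i) < cval g (suc i)

  SameDigits : ℕ → (ℕ → ℕ) → (ℕ → ℕ) → Set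
  SameDigits j n n′ = ∀ i → i < j → n (suc i) ≡ n′ (suc i)

  Represents : ℕ → ℕ → ℕ → (ℕ → ℕ) → Set
  Represents j acc m n = Admissible j n × acc + digits j n ≡ m

  admissible-lower : ∀ j {n} → Admissible (suc j) n → Admissible j n
  admissible-lower j adm i i<j = adm i (m<n⇒m<1+n i<j)

  setAt-below : ∀ j n r i → i < j → setAt n (suc j) r (suc i) ≡ n (suc i)
  setAt-below j n r i i<j = setAt-there n (suc j) r (suc i) (<⇒≢ i<j ∘ suc-injective)

  admissible-setAt : ∀ j {n r} → Admissible j n → r < cval g (suc j) →
                     Admissible (suc j) (setAt n (suc j) r)
  admissible-setAt j {n} {r} adm r<c i i<1+j with m≤n⇒m<n∨m≡n (≤-pred i<1+j)
  ... | inj₁ i<j  = subst (_< cval g (suc i)) (sym (setAt-below j n r i i<j)) (adm i i<j)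
  ... | inj₂ refl = subst (_< cval g (suc j)) (sym (setAt-here n (suc j) r)) r<c

  digits-setAt : ∀ j n r → digits (suc j) (setAt n (suc j) r) ≡ digits j n + r * g (suc j)
  digits-setAt j n r =
    cong₂ (λ s t → s + t * g (suc j))
          (sumℕ-cong j (λ i i<j → cong (_* g (suc i)) (setAt-below j n r i i<j)))
          (setAt-here n (suc j) r)

  represents-setAt : ∀ j {acc m} n {r} → r < cval g (suc j) →
    Represents j (acc + r * g (suc j)) m n → Represents (suc j) acc m (setAt n (suc j) r)
  represents-setAt j {acc} {m} n {r} r<c (adm , eq) = admissible-setAt j adm r<c , (begin
    acc + digits (suc j) (setAt n (suc j) r) ≡⟨ cong (acc +_) (digits-setAt j n r) ⟩
    acc + (digits j n + r * g (suc j))       ≡⟨ cong (acc +_) (+-comm (digits j n) _) ⟩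
    acc + (r * g (suc j) + digits j n)       ≡⟨ sym (+-assoc acc _ _) ⟩
    acc + r * g (suc j) + digits j n         ≡⟨ eq ⟩
    m                                        ∎)
    where open ≡-Reasoning

  represents-lower : ∀ j acc {m} n → Represents (suc j) acc m n →
                     Represents j (acc + n (suc j) * g (suc j)) m n
  represents-lower j acc {m} n (adm , eq) = admissible-lower j {n} adm , (begin
    acc + n (suc j) * g (suc j) + digits j n   ≡⟨ +-assoc acc _ _ ⟩
    acc + (n (suc j) * g (suc j) + digits j n) ≡⟨ cong (acc +_) (+-comm _ (digits j n)) ⟩
    acc + digits (suc j) n                     ≡⟨ eq ⟩
    m                                          ∎)
    where open ≡-Reasoning

  -- count j acc m is the number of digit vectors n with Represents j acc m n,
  -- computed by the same recursion that defines  nested.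
  count : ℕ → ℕ → ℕ → ℕ
  count zero    acc m with acc ≟ m
  ... | yes _ = 1
  ... | no  _ = 0
  count (suc j) acc m = sumℕ (cval g (suc j)) (λ r → count j (acc + r * g (suc j)) m)

  count₀-diag : ∀ acc → count zero acc acc ≡ 1
  count₀-diag acc with acc ≟ acc
  ... | yes _     = refl
  ... | no  a≢a = ⊥-elim (a≢a refl)

  count₀-off : ∀ acc m → acc ≢ m → count zero acc m ≡ 0
  count₀-off acc m acc≢m with acc ≟ m
  ... | yes acc≡m = ⊥-elim (acc≢m acc≡m)
  ... | no  _     = refl

  count-none : ∀ j acc m → (∀ n → ¬ Represents j acc m n) → count j acc m ≡ 0
  count-none zero    acc m none =
    count₀-off acc m (λ acc≡m → none (λ _ → 0) ((λ _ ()) , trans (+-identityʳ acc) acc≡m))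
  count-none (suc j) acc m none = sumℕ-vanish (cval g (suc j)) λ r r<c →
    count-none j _ m (λ n rep → none (setAt n (suc j) r) (represents-setAt j n r<c rep))

  count-unique : ∀ j acc m n₀ → Represents j acc m n₀ →
    (∀ n → Represents j acc m n → SameDigits j n n₀) → count j acc m ≡ 1
  count-unique zero    acc m n₀ (_ , eq) _ =
    subst (λ z → count zero acc z ≡ 1) (trans (sym (+-identityʳ acc)) eq) (count₀-diag acc)
  count-unique (suc j) acc m n₀ rep₀ unique =
    trans (sumℕ-single (cval g (suc j)) r₀ r₀<c others)
          (count-unique j (acc + r₀ * g (suc j)) m n₀ (represents-lower j acc n₀ rep₀) unique-below)
    where
    r₀ = n₀ (suc j)
    r₀<c : r₀ < cval g (suc j)
    r₀<c = proj₁ rep₀ j ≤-refl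
    lift : ∀ r n → r < cval g (suc j) → Represents j (acc + r * g (suc j)) m n →
           SameDigits (suc j) (setAt n (suc j) r) n₀
    lift r n r<c rep = unique (setAt n (suc j) r) (represents-setAt j n r<c rep)
    unique-below : ∀ n → Represents j (acc + r₀ * g (suc j)) m n → SameDigits j n n₀
    unique-below n rep i i<j =
      trans (sym (setAt-below j n r₀ i i<j)) (lift r₀ n r₀<c rep i (m<n⇒m<1+n i<j))
    others : ∀ r → r < cval g (suc j) → r ≢ r₀ → count j (acc + r * g (suc j)) m ≡ 0
    others r r<c r≢r₀ = count-none j _ m (λ n rep →
      r≢r₀ (trans (sym (setAt-here n (suc j) r)) (lift r n r<c rep j ≤-refl)))

module NormalForm (g : ℕ → ℕ) (g₀>0 : 0 < g 0) where
  open Digits g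

  -- All d_i are positive since d_0 = g_0 > 0; hence all c_i are nonzero.
  d-pos : ∀ i → 0 < dval g i
  d-pos zero    = g₀>0
  d-pos (suc i) =
    n≢0⇒n>0 (gcd[m,n]≢0 (dval g i) (g (suc i)) (inj₁ (λ d≡0 → <⇒≢ (d-pos i) (sym d≡0))))

  c-nonZero : ∀ j → NonZero (cval g (suc j))
  c-nonZero j = quotient≢0 (gcd[m,n]∣m (dval g j) (g (suc j))) {{>-nonZero (d-pos j)}}

  d-divides : ∀ j i → i ≤ j → dval g j ∣ g i
  d-divides zero    .zero z≤n   = ∣-refl
  d-divides (suc j) i     i≤1+j with m≤n⇒m<n∨m≡n i≤1+j
  ... | inj₁ i<1+j = ∣-trans (gcd[m,n]∣m (dval g j) (g (suc j))) (d-divides j i (≤-pred i<1+j))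
  ... | inj₂ refl  = gcd[m,n]∣n (dval g j) (g (suc j))

  d-divides-form : ∀ j x n → dval g j ∣ x * g 0 + digits j n
  d-divides-form j x n =
    ∣m∣n⇒∣m+n (∣n⇒∣m*n x (d-divides j 0 z≤n))
              (sumℕ-divisible j (λ i i<j → ∣n⇒∣m*n (n (suc i)) (d-divides j (suc i) i<j)))

  -- If d_j ∣ δ g_{j+1} then c_{j+1} ∣ δ, because c_{j+1} = d_j / d_{j+1} and
  -- g_{j+1} / d_{j+1} are coprime.
  c-divides : ∀ j δ → dval g j ∣ δ * g (suc j) → cval g (suc j) ∣ δ
  c-divides j δ d∣δG = coprime-divisor coprime (subst (c ∣_) (*-comm δ e) c∣δe)
    where
    d = dval g j
    G = g (suc j)
    h = gcd d G
    instance
      h-nonZero : NonZero h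
      h-nonZero = >-nonZero (d-pos (suc j))
    c = cval g (suc j)
    e = quotient (gcd[m,n]∣n d G)
    d/h≡c : d / h ≡ c
    d/h≡c = n/m≡quotient (gcd[m,n]∣m d G)
    coprime : Coprime c e
    coprime = subst₂ Coprime d/h≡c (n/m≡quotient (gcd[m,n]∣n d G)) (coprime-/gcd d G)
    δG≡δeh : δ * G ≡ δ * e * h
    δG≡δeh = trans (cong (δ *_) (_∣_.equality (gcd[m,n]∣n d G))) (sym (*-assoc δ e h))
    c∣δe : c ∣ δ * e
    c∣δe = subst (_∣ δ * e) d/h≡c (m∣n*o⇒m/n∣o (gcd[m,n]∣m d G) (subst (d ∣_) δG≡δeh d∣δG))

  -- The case u ≤ u′ of digit-unique: then d_j ∣ (u′ - u) g_{j+1}, so c_{j+1} ∣ u′ - u < c_{j+1}.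
  digit-unique-≤ : ∀ j {a a′ u u′} → dval g j ∣ a → dval g j ∣ a′ → u ≤ u′ →
    u′ < cval g (suc j) → a + u * g (suc j) ≡ a′ + u′ * g (suc j) → u ≡ u′
  digit-unique-≤ j {a} {a′} {u} {u′} d∣a d∣a′ u≤u′ u′<c eq = begin
    u           ≡⟨ sym (+-identityʳ u) ⟩
    u + 0       ≡⟨ cong (u +_) (sym δ≡0) ⟩
    u + δ       ≡⟨ m+[n∸m]≡n u≤u′ ⟩
    u′          ∎
    where
    open ≡-Reasoning
    G = g (suc j)
    δ = u′ ∸ u
    a≡a′+δG : a ≡ a′ + δ * G
    a≡a′+δG = +-cancelʳ-≡ (u * G) a (a′ + δ * G) (begin
      a + u * G          ≡⟨ eq ⟩
      a′ + u′ * G        ≡⟨ cong (λ z → a′ + z * G) (sym (m+[n∸m]≡n u≤u′)) ⟩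
      a′ + (u + δ) * G   ≡⟨ solve 4 (λ a′ u δ G → a′ :+ (u :+ δ) :* G
                                                 := (a′ :+ δ :* G) :+ u :* G) refl a′ u δ G ⟩
      a′ + δ * G + u * G ∎)
    c∣δ : cval g (suc j) ∣ δ
    c∣δ = c-divides j δ (∣m+n∣m⇒∣n (subst (dval g j ∣_) a≡a′+δG d∣a) d∣a′)
    δ≡0 : δ ≡ 0
    δ≡0 with δ | c∣δ | ≤-<-trans (m∸n≤m u′ u) u′<c
    ... | zero  | _    | _   = refl
    ... | suc _ | c∣δ′ | δ<c = ⊥-elim (>⇒∤ δ<c c∣δ′)

  digit-unique : ∀ j {a a′ u u′} → dval g j ∣ a → dval g j ∣ a′ →
    u < cval g (suc j) → u′ < cval g (suc j) →
    a + u * g (suc j) ≡ a′ + u′ * g (suc j) → u ≡ u′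
  digit-unique j {u = u} {u′} d∣a d∣a′ u<c u′<c eq with ≤-total u u′
  ... | inj₁ u≤u′ = digit-unique-≤ j d∣a d∣a′ u≤u′ u′<c eq
  ... | inj₂ u′≤u = sym (digit-unique-≤ j d∣a′ d∣a u′≤u u<c (sym eq))

  form-unique : ∀ j x y n n′ → Admissible j n → Admissible j n′ →
    x * g 0 + digits j n ≡ y * g 0 + digits j n′ → x ≡ y × SameDigits j n n′
  form-unique zero    x y n n′ _ _ eq =
    *-cancelʳ-≡ x y (g 0) {{>-nonZero g₀>0}} (trans (sym (+-identityʳ _)) (trans eq (+-identityʳ _)))
    , λ _ ()
  form-unique (suc j) x y n n′ adm adm′ eq = proj₁ lower , same
    where
    G = g (suc j)
    split : x * g 0 + digits j n + n (suc j) * G ≡ y * g 0 + digits j n′ + n′ (suc j) * G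
    split = trans (+-assoc (x * g 0) _ _) (trans eq (sym (+-assoc (y * g 0) _ _)))
    top : n (suc j) ≡ n′ (suc j)
    top = digit-unique j (d-divides-form j x n) (d-divides-form j y n′)
                         (adm j ≤-refl) (adm′ j ≤-refl) split
    lower : x ≡ y × SameDigits j n n′
    lower = form-unique j x y n n′ (admissible-lower j {n} adm) (admissible-lower j {n′} adm′)
      (+-cancelʳ-≡ (n (suc j) * G) _ _ (trans split (cong (λ t → _ + t * G) (sym top))))
    same : SameDigits (suc j) n n′
    same i i<1+j with m≤n⇒m<n∨m≡n (≤-pred i<1+j)
    ... | inj₁ i<j  = proj₂ lower i i<j
    ... | inj₂ refl = top

  NormalForm : ℕ → ℕ → Set
  NormalForm j m = Σ ℕ λ x → Σ (ℕ → ℕ) λ n → Admissible j n × x * g 0 + digits j n ≡ m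

  -- Smoothness lets the coefficient of g_{j+1} be reduced below c_{j+1}: the
  -- excess multiple of  c_{j+1} g_{j+1} ∈ ⟨g_0, …, g_j⟩  is moved to lower generators.
  carry-top : ∀ {k} → Smooth k g → ∀ j → suc j ≤ k → (a : ℕ → ℕ) →
    Σ (ℕ → ℕ) λ a′ → Σ ℕ λ r → r < cval g (suc j) ×
      sumℕ (suc (suc j)) (λ i → a i * g i) ≡ sumℕ (suc j) (λ i → a′ i * g i) + r * g (suc j)
  carry-top smooth j 1+j≤k a with smooth (suc j) (s≤s z≤n) 1+j≤k
  ... | b , b≡cG = (λ i → a i + q * b i) , r , m%n<n (a (suc j)) c , (begin
    Sa + a (suc j) * G           ≡⟨ cong (λ t → Sa + t * G) (m≡m%n+[m/n]*n (a (suc j)) c) ⟩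
    Sa + (r + q * c) * G         ≡⟨ solve 5 (λ Sa q c G r → Sa :+ (r :+ q :* c) :* G
                                            := (Sa :+ q :* (c :* G)) :+ r :* G) refl Sa q c G r ⟩
    Sa + q * (c * G) + r * G     ≡⟨ cong (λ t → Sa + q * t + r * G) (sym b≡cG) ⟩
    Sa + q * Sb + r * G          ≡⟨ cong (_+ r * G) (sym (sumℕ-combine (suc j) a b g q)) ⟩
    sumℕ (suc j) (λ i → (a i + q * b i) * g i) + r * G ∎)
    where
    open ≡-Reasoning
    G = g (suc j)
    c = cval g (suc j)
    instance
      _ = c-nonZero j
    q = a (suc j) / c
    r = a (suc j) % c
    Sa = sumℕ (suc j) (λ i → a i * g i)
    Sb = sumℕ (suc j) (λ i → b i * g i)

  normal-form : ∀ {k} → Smooth k g → ∀ j → j ≤ k → ∀ {m} → InGen (suc j) g m → NormalForm j m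
  normal-form smooth zero    _     (a , refl) = a 0 , (λ _ → 0) , (λ _ ()) , +-identityʳ _
  normal-form smooth (suc j) 1+j≤k (a , refl) with carry-top smooth j 1+j≤k a
  ... | a′ , r , r<c , carried with normal-form smooth j (<⇒≤ 1+j≤k) (a′ , refl)
  ... | x , n , adm , eq = x , setAt n (suc j) r , admissible-setAt j adm r<c , (begin
    x * g 0 + digits (suc j) (setAt n (suc j) r) ≡⟨ cong (x * g 0 +_) (digits-setAt j n r) ⟩
    x * g 0 + (digits j n + r * g (suc j))       ≡⟨ sym (+-assoc (x * g 0) _ _) ⟩
    x * g 0 + digits j n + r * g (suc j)         ≡⟨ cong (_+ r * g (suc j)) eq ⟩
    sumℕ (suc j) (λ i → a′ i * g i) + r * g (suc j) ≡⟨ sym carried ⟩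
    sumℕ (suc (suc j)) (λ i → a i * g i)         ∎)
    where open ≡-Reasoning

gapIndicator : {P : ℕ → Set} → ((n : ℕ) → Dec (P n)) → ℕ → ℕ
gapIndicator dec n with dec n
... | yes _ = 0
... | no  _ = 1

-- The Apéry set of S = ⟨g_0, …, g_k⟩ with respect to g_0 consists of the m ∈ S with
-- m - g_0 ∉ S.  For smooth g its elements are exactly the values Σ n_i g_i of
-- admissible digit vectors, each attained once; in counting form:
--   count(m) + [m ∉ S] = 1          for m < g_0,
--   count(g_0 + n) + [g_0 + n ∉ S] = [n ∉ S].

module AperySet (g : ℕ → ℕ) (g₀>0 : 0 < g 0) (k : ℕ) (smooth : Smooth k g)
                (dec : (n : ℕ) → Dec (InS k g n)) where
  open Digits g
  open NormalForm g g₀>0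

  gap : ℕ → ℕ
  gap = gapIndicator dec

  form-in-S : ∀ x n → InS k g (x * g 0 + digits k n)
  form-in-S x n = coefficients , sumℕ-peel k (λ i → coefficients i * g i)
    where
    coefficients : ℕ → ℕ
    coefficients zero    = x
    coefficients (suc i) = n (suc i)

  S-shift : ∀ {s} → InS k g s → InS k g (g 0 + s)
  S-shift {s} (a , a≡s) = a′ , (begin
    sumℕ (suc k) (λ i → a′ i * g i)              ≡⟨ sumℕ-peel k (λ i → a′ i * g i) ⟩
    g 0 + a 0 * g 0 + sumℕ k (λ i → a (suc i) * g (suc i))
                                                 ≡⟨ +-assoc (g 0) _ _ ⟩
    g 0 + (a 0 * g 0 + sumℕ k (λ i → a (suc i) * g (suc i)))
                                                 ≡⟨ cong (g 0 +_) (sym (sumℕ-peel k (λ i → a i * g i))) ⟩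
    g 0 + sumℕ (suc k) (λ i → a i * g i)         ≡⟨ cong (g 0 +_) a≡s ⟩
    g 0 + s                                      ∎)
    where
    open ≡-Reasoning
    a′ : ℕ → ℕ
    a′ zero    = suc (a 0)
    a′ (suc i) = a (suc i)

  -- Elements of the Apéry set have exactly one representation, elements outside S
  -- none, and elements g_0 + s with s ∈ S none (their normal form has x ≥ 1).
  count-apery : ∀ m → InS k g m → (∀ s → InS k g s → g 0 + s ≢ m) → count k 0 m ≡ 1
  count-apery m m∈S not-shift with normal-form smooth k ≤-refl m∈S
  ... | suc x , n , _ , eq =
    ⊥-elim (not-shift _ (form-in-S x n) (trans (sym (+-assoc (g 0) (x * g 0) _)) eq))
  ... | zero  , n , adm , eq = count-unique k 0 m n (adm , eq) (λ n′ (adm′ , eq′) →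
    proj₂ (form-unique k 0 0 n′ n adm′ adm (trans eq′ (sym eq))))

  count-gap : ∀ m → ¬ InS k g m → count k 0 m ≡ 0
  count-gap m m∉S = count-none k 0 m (λ n (_ , eq) → m∉S (subst (InS k g) eq (form-in-S 0 n)))

  count-shift : ∀ {s} → InS k g s → count k 0 (g 0 + s) ≡ 0
  count-shift {s} s∈S with normal-form smooth k ≤-refl s∈S
  ... | x , n′ , adm′ , eq′ = count-none k 0 (g 0 + s) (λ n (adm , eq) →
    0≢1+n (proj₁ (form-unique k 0 (suc x) n n′ adm adm′ (begin
      digits k n                        ≡⟨ eq ⟩
      g 0 + s                           ≡⟨ cong (g 0 +_) (sym eq′) ⟩
      g 0 + (x * g 0 + digits k n′)     ≡⟨ sym (+-assoc (g 0) _ _) ⟩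
      suc x * g 0 + digits k n′         ∎))))
    where open ≡-Reasoning

  count-below-g₀ : ∀ m → m < g 0 → count k 0 m + gap m ≡ 1
  count-below-g₀ m m<g₀ with dec m
  ... | yes m∈S = trans (+-identityʳ _) (count-apery m m∈S (λ s _ g₀+s≡m →
                    <⇒≱ m<g₀ (subst (g 0 ≤_) g₀+s≡m (m≤m+n (g 0) s))))
  ... | no  m∉S = cong (_+ 1) (count-gap m m∉S)

  count-above-g₀ : ∀ n → count k 0 (g 0 + n) + gap (g 0 + n) ≡ gap n
  count-above-g₀ n with dec n | dec (g 0 + n)
  ... | yes n∈S | yes _    = cong (_+ 0) (count-shift n∈S)
  ... | yes n∈S | no  g₀+n∉S = ⊥-elim (g₀+n∉S (S-shift n∈S))
  ... | no  n∉S | yes g₀+n∈S = cong (_+ 0) (count-apery _ g₀+n∈S (λ s s∈S g₀+s≡g₀+n →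
                                 n∉S (subst (InS k g) (+-cancelˡ-≡ (g 0) s n g₀+s≡g₀+n) s∈S)))
  ... | no  n∉S | no  g₀+n∉S = cong (_+ 1) (count-gap _ g₀+n∉S)

  gap-beyond : ∀ B → (∀ n → B ≤ n → InS k g n) → ∀ n → B ≤ n → gap n ≡ 0
  gap-beyond B cofinite n B≤n with dec n
  ... | yes _   = refl
  ... | no  n∉S = ⊥-elim (n∉S (cofinite n B≤n))

  count-beyond : ∀ B → (∀ n → B ≤ n → InS k g n) → ∀ m → g 0 + B ≤ m → count k 0 m ≡ 0
  count-beyond B cofinite m g₀+B≤m =
    subst (λ z → count k 0 z ≡ 0) (m+[n∸m]≡n (m+n≤o⇒m≤o (g 0) g₀+B≤m))
          (count-shift (cofinite (m ∸ g 0) (m+n≤o⇒m≤o∸n B (subst (_≤ m) (+-comm (g 0) B) g₀+B≤m))))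

module GroupSums {a ℓ} (A : AbelianGroup a ℓ) where
  open AbelianGroup A renaming (refl to ≈-refl; sym to ≈-sym; trans to ≈-trans)
  open import Algebra.Properties.Monoid.Mult monoid
    using (×-homo-1; ×-homo-+; ×-congˡ) renaming (_×_ to _·_)
  open import Algebra.Properties.CommutativeSemigroup commutativeSemigroup using (interchange)
  open import Algebra.Properties.AbelianGroup A using (⁻¹-∙-comm; xyx⁻¹≈y)
  open import Algebra.Properties.Group group using (ε⁻¹≈ε)
  open import Relation.Binary.Reasoning.Setoid setoid

  gs : ℕ → (ℕ → Carrier) → Carrier
  gs = gsum A

  gsum-cong : ∀ n {h h′ : ℕ → Carrier} → (∀ i → i < n → h i ≈ h′ i) → gs n h ≈ gs n h′
  gsum-cong zero    eq = ≈-refl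
  gsum-cong (suc n) eq = ∙-cong (gsum-cong n (λ i i<n → eq i (m<n⇒m<1+n i<n))) (eq n ≤-refl)

  gsum-vanish : ∀ n {h : ℕ → Carrier} → (∀ i → i < n → h i ≈ ε) → gs n h ≈ ε
  gsum-vanish zero    h≈ε = ≈-refl
  gsum-vanish (suc n) h≈ε =
    ≈-trans (∙-cong (gsum-vanish n (λ i i<n → h≈ε i (m<n⇒m<1+n i<n))) (h≈ε n ≤-refl)) (identityˡ ε)

  gsum-single : ∀ n {h : ℕ → Carrier} p → p < n → (∀ i → i < n → i ≢ p → h i ≈ ε) → gs n h ≈ h p
  gsum-single (suc n) {h} p p<1+n others with m≤n⇒m<n∨m≡n (≤-pred p<1+n)
  ... | inj₁ p<n  = ≈-trans (∙-cong (gsum-single n p p<n (λ i i<n → others i (m<n⇒m<1+n i<n)))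
                                    (others n ≤-refl (λ n≡p → <⇒≢ p<n (sym n≡p))))
                            (identityʳ (h p))
  ... | inj₂ refl = ≈-trans (∙-congʳ (gsum-vanish p (λ i i<p → others i (m<n⇒m<1+n i<p) (<⇒≢ i<p))))
                            (identityˡ (h p))

  gsum-∙ : ∀ n (h h′ : ℕ → Carrier) → gs n (λ i → h i ∙ h′ i) ≈ gs n h ∙ gs n h′
  gsum-∙ zero    h h′ = ≈-sym (identityˡ ε)
  gsum-∙ (suc n) h h′ = ≈-trans (∙-congʳ (gsum-∙ n h h′)) (interchange _ _ _ _)

  gsum-⁻¹ : ∀ n (h : ℕ → Carrier) → gs n (λ i → h i ⁻¹) ≈ gs n h ⁻¹
  gsum-⁻¹ zero    h = ≈-sym ε⁻¹≈ε
  gsum-⁻¹ (suc n) h = ≈-trans (∙-congʳ (gsum-⁻¹ n h)) (⁻¹-∙-comm _ _)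

  gsum-swap : ∀ m n (h : ℕ → ℕ → Carrier) →
    gs m (λ i → gs n (h i)) ≈ gs n (λ j → gs m (λ i → h i j))
  gsum-swap zero    n h = ≈-sym (gsum-vanish n (λ _ _ → ≈-refl))
  gsum-swap (suc m) n h = ≈-trans (∙-congʳ (gsum-swap m n h)) (≈-sym (gsum-∙ n _ _))

  gsum-scalar : ∀ n (w : ℕ → ℕ) x → gs n (λ r → w r · x) ≈ sumℕ n w · x
  gsum-scalar zero    w x = ≈-refl
  gsum-scalar (suc n) w x = ≈-trans (∙-congʳ (gsum-scalar n w x)) (≈-sym (×-homo-+ x (sumℕ n w) (w n)))

  gsum-split : ∀ m n (h : ℕ → Carrier) → gs (m + n) h ≈ gs m h ∙ gs n (λ i → h (m + i))
  gsum-split m zero    h = subst (λ z → gs z h ≈ gs m h ∙ ε) (sym (+-identityʳ m)) (≈-sym (identityʳ _))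
  gsum-split m (suc n) h = subst (λ z → gs z h ≈ gs m h ∙ gs (suc n) (λ i → h (m + i))) (sym (+-suc m n))
    (≈-trans (∙-congʳ (gsum-split m n h)) (assoc _ _ _))

  gsum-truncate : ∀ B n (h : ℕ → Carrier) → (∀ i → h (B + i) ≈ ε) → gs (B + n) h ≈ gs B h
  gsum-truncate B n h tail≈ε =
    ≈-trans (gsum-split B n h) (≈-trans (∙-congˡ (gsum-vanish n (λ i _ → tail≈ε i))) (identityʳ _))

  rebalance : ∀ w r p l → w ∙ r ≈ p ∙ l → l ∙ r ⁻¹ ≈ w ∙ p ⁻¹
  rebalance w r p l balance = begin
    l ∙ r ⁻¹                    ≈⟨ ∙-congʳ (≈-sym (xyx⁻¹≈y p l)) ⟩
    p ∙ l ∙ p ⁻¹ ∙ r ⁻¹         ≈⟨ ∙-congʳ (∙-congʳ (≈-sym balance)) ⟩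
    w ∙ r ∙ p ⁻¹ ∙ r ⁻¹         ≈⟨ ∙-congʳ (assoc w r (p ⁻¹)) ⟩
    w ∙ (r ∙ p ⁻¹) ∙ r ⁻¹       ≈⟨ ∙-congʳ (∙-congˡ (comm r (p ⁻¹))) ⟩
    w ∙ (p ⁻¹ ∙ r) ∙ r ⁻¹       ≈⟨ ∙-congʳ (≈-sym (assoc w (p ⁻¹) r)) ⟩
    w ∙ p ⁻¹ ∙ r ∙ r ⁻¹         ≈⟨ assoc (w ∙ p ⁻¹) r (r ⁻¹) ⟩
    w ∙ p ⁻¹ ∙ (r ∙ r ⁻¹)       ≈⟨ ∙-congˡ (inverseʳ r) ⟩
    w ∙ p ⁻¹ ∙ ε                ≈⟨ identityʳ (w ∙ p ⁻¹) ⟩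
    w ∙ p ⁻¹                    ∎

  telescoping : ∀ p B (w γ : ℕ → ℕ) (f : ℕ → Carrier) →
    (∀ m → m < p → w m + γ m ≡ 1) →
    (∀ n → w (p + n) + γ (p + n) ≡ γ n) →
    (∀ n → B ≤ n → γ n ≡ 0) →
    gs B (λ n → γ n · f (n + p) ∙ (γ n · f n) ⁻¹) ≈ gs (p + B) (λ m → w m · f m) ∙ gs p f ⁻¹
  telescoping p B w γ f below above beyond = begin
    gs B (λ n → γ n · f (n + p) ∙ (γ n · f n) ⁻¹) ≈⟨ gsum-∙ B _ _ ⟩
    L ∙ gs B (λ n → (γ n · f n) ⁻¹)               ≈⟨ ∙-congˡ (gsum-⁻¹ B _) ⟩
    L ∙ R ⁻¹                                      ≈⟨ rebalance W R (gs p f) L balance ⟩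
    W ∙ gs p f ⁻¹                                 ∎
    where
    L = gs B (λ n → γ n · f (n + p))
    γf : ℕ → Carrier
    γf n = γ n · f n
    R = gs B γf
    W = gs (p + B) (λ m → w m · f m)
    R-extended : gs (p + B) (λ m → γ m · f m) ≈ R
    R-extended = ≈-trans (reflexive (cong (λ z → gs z γf) (+-comm p B)))
      (gsum-truncate B p γf (λ i → reflexive (cong (_· f (B + i)) (beyond (B + i) (m≤m+n B i)))))
    low : ∀ m → m < p → (w m + γ m) · f m ≈ f m
    low m m<p = ≈-trans (×-congˡ (below m m<p)) (×-homo-1 (f m))
    high : ∀ n → n < B → (w (p + n) + γ (p + n)) · f (p + n) ≈ γ n · f (n + p)
    high n _ = ≈-trans (×-congˡ (above n)) (reflexive (cong (λ t → γ n · f t) (+-comm p n)))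
    balance : W ∙ R ≈ gs p f ∙ L
    balance = begin
      W ∙ R                                           ≈⟨ ∙-congˡ (≈-sym R-extended) ⟩
      W ∙ gs (p + B) (λ m → γ m · f m)                ≈⟨ ≈-sym (gsum-∙ (p + B) _ _) ⟩
      gs (p + B) (λ m → w m · f m ∙ γ m · f m)        ≈⟨ gsum-cong (p + B) (λ m _ → ≈-sym (×-homo-+ (f m) (w m) (γ m))) ⟩
      gs (p + B) (λ m → (w m + γ m) · f m)            ≈⟨ gsum-split p B _ ⟩
      gs p (λ m → (w m + γ m) · f m) ∙ gs B (λ n → (w (p + n) + γ (p + n)) · f (p + n))
                                                      ≈⟨ ∙-cong (gsum-cong p low) (gsum-cong B high) ⟩
      gs p f ∙ L                                      ∎

  nested-as-count : ∀ (g : ℕ → ℕ) (f : ℕ → Carrier) j acc M →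
    (∀ m → M ≤ m → Digits.count g j acc m ≡ 0) →
    nested A g f j acc ≈ gs M (λ m → Digits.count g j acc m · f m)
  nested-as-count g f zero    acc M beyond = ≈-sym (begin
    gs M (λ m → count zero acc m · f m) ≈⟨ gsum-single M acc acc<M off ⟩
    count zero acc acc · f acc          ≈⟨ ×-congˡ (count₀-diag acc) ⟩
    1 · f acc                           ≈⟨ ×-homo-1 (f acc) ⟩
    f acc                               ∎)
    where
    open Digits g
    acc<M : acc < M
    acc<M = ≰⇒> (λ M≤acc → 1+n≢0 (trans (sym (count₀-diag acc)) (beyond acc M≤acc)))
    off : ∀ m → m < M → m ≢ acc → count zero acc m · f m ≈ ε
    off m _ m≢acc = ×-congˡ (count₀-off acc m (m≢acc ∘ sym))
  nested-as-count g f (suc j) acc M beyond = begin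
    gs c (λ r → nested A g f j (acc + r * G))                 ≈⟨ gsum-cong c (λ r r<c →
        nested-as-count g f j (acc + r * G) M (λ m M≤m → sumℕ-vanish⁻ c (beyond m M≤m) r r<c)) ⟩
    gs c (λ r → gs M (λ m → count j (acc + r * G) m · f m))   ≈⟨ gsum-swap c M _ ⟩
    gs M (λ m → gs c (λ r → count j (acc + r * G) m · f m))   ≈⟨ gsum-cong M (λ m _ →
        gsum-scalar c (λ r → count j (acc + r * G) m) (f m)) ⟩
    gs M (λ m → count (suc j) acc m · f m)                    ∎
    where
    open Digits g
    c = cval g (suc j)
    G = g (suc j)

  nrSum-as-gap : ∀ k g dec B (f : ℕ → Carrier) →
    nrSum A k g dec B f ≈
      gs B (λ n → gapIndicator dec n · f (n + g 0) ∙ (gapIndicator dec n · f n) ⁻¹)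
  nrSum-as-gap k g dec zero    f = ≈-refl
  nrSum-as-gap k g dec (suc B) f with dec B
  ... | yes _ = ∙-cong (nrSum-as-gap k g dec B f) (≈-sym (inverseʳ ε))
  ... | no  _ = ∙-cong (nrSum-as-gap k g dec B f)
                       (≈-sym (∙-cong (×-homo-1 _) (⁻¹-cong (×-homo-1 _))))

corollary3p7 : ∀ {a ℓ} (A : AbelianGroup a ℓ) (k : ℕ) (g : ℕ → ℕ) →
    ((i : ℕ) → i ≤ k → 0 < g i) →
    dval g k ≡ 1 →
    Smooth k g →
    (dec : (n : ℕ) → Dec (InS k g n)) →
    (B : ℕ) → ((n : ℕ) → B ≤ n → InS k g n) →
    (f : ℕ → AbelianGroup.Carrier A) →
    AbelianGroup._≈_ A
    (nrSum A k g dec B f)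
    (AbelianGroup._∙_ A (nested A g f k 0) (AbelianGroup._⁻¹ A (gsum A (g 0) f)))
corollary3p7 A k g positive _ smooth dec B cofinite f = begin
  nrSum A k g dec B f                                      ≈⟨ nrSum-as-gap k g dec B f ⟩
  gs B (λ n → gap n · f (n + g 0) ∙ (gap n · f n) ⁻¹)      ≈⟨ telescoping (g 0) B (count k 0) gap f
                                                                count-below-g₀ count-above-g₀
                                                                (gap-beyond B cofinite) ⟩
  gs (g 0 + B) (λ m → count k 0 m · f m) ∙ gs (g 0) f ⁻¹   ≈⟨ ∙-congʳ (≈-sym (nested-as-count g f k 0
                                                                (g 0 + B) (count-beyond B cofinite))) ⟩
  nested A g f k 0 ∙ gs (g 0) f ⁻¹                          ∎
  where
  open AbelianGroup A renaming (sym to ≈-sym)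
  open import Algebra.Properties.Monoid.Mult monoid using () renaming (_×_ to _·_)
  open import Relation.Binary.Reasoning.Setoid setoid
  open GroupSums A
  open Digits g
  open AperySet g (positive 0 z≤n) k smooth dec
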